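{- If a finite simple graph $G$ is positive, then so is $G(r)$ for every positive integer $r$.
   Context: $G(r)$ is the graph obtained from $G$ by replacing each vertex with $r$ twins: its vertex set is $V(G)\times[r]$, and $(u,a)$ is adjacent to $(v,b)$ iff $uv\in E(G)$. A simple graph $G$ is positive if $\hom(G,H)=\sum_{\varphi:V(G)\to V(H)}\prod_{uv\in E(G)}\beta_{\varphi(u)\varphi(v)}\ge0$ for every graph $H$ with real (possibly negative) symmetric edge weights $\beta$, loops allowed.
   Formalization: The symmetric edge weights β of the graphs H are rational instead of real. -}

module Defs where

open import Data.Nat using (ℕ; zero; suc; _*_; _<ᵇ_)
open import Data.Bool using (Bool; true; false; if_then_else_; _∧_)
open import Data.Fin using (Fin; toℕ; remQuot)
import Data.Fin as F
open import Data.Vec.Functional using (_∷_)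
open import Data.Product using (proj₁; proj₂)
open import Data.Rational using (ℚ; 0ℚ; 1ℚ; _+_; _≤_) renaming (_*_ to _·_)
open import Relation.Binary.PropositionalEquality using (_≡_)

record SimpleGraph (n : ℕ) : Set where
  field
    adj    : Fin n → Fin n → Bool
    sym    : ∀ u v → adj u v ≡ adj v u
    irrefl : ∀ u → adj u u ≡ false
open SimpleGraph public

sumFin : ∀ m → (Fin m → ℚ) → ℚ
sumFin zero    f = 0ℚ
sumFin (suc m) f = f F.zero + sumFin m (λ i → f (F.suc i))

prodFin : ∀ m → (Fin m → ℚ) → ℚ
prodFin zero    f = 1ℚ
prodFin (suc m) f = f F.zero · prodFin m (λ i → f (F.suc i))

sumMaps : ∀ n m → ((Fin n → Fin m) → ℚ) → ℚ
sumMaps zero    m f = f (λ ())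
sumMaps (suc n) m f = sumFin m (λ i → sumMaps n m (λ φ → f (i ∷ φ)))

-- hom(G,H) for H on vertex set Fin m with symmetric weight matrix β
-- (loops allowed: β i i arbitrary; non-edges have weight 0).
-- Product over the edges uv of G, each unordered edge counted once (u < v).
hom : ∀ {n} → SimpleGraph n → (m : ℕ) → (Fin m → Fin m → ℚ) → ℚ
hom {n} G m β = sumMaps n m (λ φ →
  prodFin n (λ u → prodFin n (λ v →
    if adj G u v ∧ (toℕ u <ᵇ toℕ v) then β (φ u) (φ v) else 1ℚ)))

SymmetricWeights : ∀ m → (Fin m → Fin m → ℚ) → Set
SymmetricWeights m β = ∀ i j → β i j ≡ β j i

Positive : ∀ {n} → SimpleGraph n → Set
Positive G = ∀ (m : ℕ) (β : Fin m → Fin m → ℚ) → SymmetricWeights m β → 0ℚ ≤ hom G m β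

-- G(r): vertex set V(G) × [r], encoded as Fin (n * r) via remQuot;
-- (u,a) ~ (v,b) iff uv ∈ E(G).
blowup : ∀ {n} → SimpleGraph n → (r : ℕ) → SimpleGraph (n * r)
blowup {n} G r = record
  { adj    = λ x y → adj G (proj₁ (remQuot r x)) (proj₁ (remQuot r y))
  ; sym    = λ x y → sym G (proj₁ (remQuot r x)) (proj₁ (remQuot r y))
  ; irrefl = λ x → irrefl G (proj₁ (remQuot r x))
  }

-- Grouping the r twins of each vertex, a map V(G(r)) → V(H) is the same as a
-- map V(G) → V(H)ʳ, and the r² edges between the twins of u and v contribute
-- ∏_{a,b} β(k_a, l_b) for the tuples k, l assigned to u and v.  Hence
-- hom(G(r), H) = hom(G, H⁽ʳ⁾), where H⁽ʳ⁾ has the r-tuples of vertices of H as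
-- vertices and these products as (symmetric) edge weights, and positivity of G
-- applied to H⁽ʳ⁾ gives positivity of G(r).
module Submission where

open import Defs hiding (sym)
open import Algebra.Core using (Op₂)
open import Algebra.Bundles using (CommutativeSemigroup)
open import Algebra.Structures using (IsCommutativeMonoid)
import Algebra.Properties.CommutativeSemigroup as CommutativeSemigroupProperties
open import Data.Bool using (Bool; true; false; if_then_else_; _∧_)
open import Data.Fin using (Fin; zero; suc; toℕ; remQuot; combine; finToFun; _↑ˡ_; _↑ʳ_; splitAt)
open import Data.Fin.Properties using (remQuot-combine; combine-monoˡ-<; <-cmp)
open import Data.Nat using (ℕ; suc; _+_; _*_; _^_; _<_; _≤_; _<ᵇ_; s≤s)
open import Data.Nat.Properties using (<⇒≤)
open import Data.Product using (_×_; proj₁; proj₂)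
open import Data.Rational using (ℚ; 0ℚ; 1ℚ) renaming (_≤_ to _≤ℚ_)
import Data.Rational.Properties as ℚ
open import Data.Sum using (inj₁; inj₂)
open import Data.Vec.Functional using (_∷_; _++_)
open import Data.Vec.Functional.Properties using (++-cong)
open import Function using (_∘_; const)
open import Level using (0ℓ)
open import Relation.Binary using (tri<; tri≈; tri>)
open import Relation.Binary.PropositionalEquality
open import Relation.Nullary using (contradiction)

module FinFold {A : Set} {_∙_ : Op₂ A} {ε : A} (isCM : IsCommutativeMonoid _≡_ _∙_ ε)
  (fold : ∀ m → (Fin m → A) → A)
  (fold-zero : ∀ f → fold 0 f ≡ ε)
  (fold-suc : ∀ m f → fold (suc m) f ≡ f zero ∙ fold m (f ∘ suc)) where

  open IsCommutativeMonoid isCM using (assoc; identityˡ; isCommutativeSemigroup)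

  private
    ∙-commutativeSemigroup : CommutativeSemigroup 0ℓ 0ℓ
    ∙-commutativeSemigroup = record { isCommutativeSemigroup = isCommutativeSemigroup }

  open CommutativeSemigroupProperties ∙-commutativeSemigroup using (interchange)
  open ≡-Reasoning

  fold-cong : ∀ m {f g : Fin m → A} → f ≗ g → fold m f ≡ fold m g
  fold-cong 0       {f} {g} f≗g = trans (fold-zero f) (sym (fold-zero g))
  fold-cong (suc m) {f} {g} f≗g = begin
    fold (suc m) f
      ≡⟨ fold-suc m f ⟩
    f zero ∙ fold m (f ∘ suc)
      ≡⟨ cong₂ _∙_ (f≗g zero) (fold-cong m (f≗g ∘ suc)) ⟩
    g zero ∙ fold m (g ∘ suc)
      ≡⟨ fold-suc m g ⟨
    fold (suc m) g
      ∎

  fold-ε : ∀ m → fold m (const ε) ≡ ε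
  fold-ε 0       = fold-zero _
  fold-ε (suc m) = trans (fold-suc m _) (trans (cong (ε ∙_) (fold-ε m)) (identityˡ ε))

  fold-distrib : ∀ m (f g : Fin m → A) → fold m (λ i → f i ∙ g i) ≡ fold m f ∙ fold m g
  fold-distrib 0       f g = begin
    fold 0 _
      ≡⟨ fold-zero _ ⟩
    ε
      ≡⟨ identityˡ ε ⟨
    ε ∙ ε
      ≡⟨ cong₂ _∙_ (fold-zero f) (fold-zero g) ⟨
    fold 0 f ∙ fold 0 g
      ∎
  fold-distrib (suc m) f g = begin
    fold (suc m) (λ i → f i ∙ g i)
      ≡⟨ fold-suc m _ ⟩
    (f zero ∙ g zero) ∙ fold m (λ i → f (suc i) ∙ g (suc i))
      ≡⟨ cong (_ ∙_) (fold-distrib m _ _) ⟩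
    (f zero ∙ g zero) ∙ (fold m (f ∘ suc) ∙ fold m (g ∘ suc))
      ≡⟨ interchange _ _ _ _ ⟩
    (f zero ∙ fold m (f ∘ suc)) ∙ (g zero ∙ fold m (g ∘ suc))
      ≡⟨ cong₂ _∙_ (fold-suc m f) (fold-suc m g) ⟨
    fold (suc m) f ∙ fold (suc m) g
      ∎

  fold-comm : ∀ m n (h : Fin m → Fin n → A) →
              fold m (λ i → fold n (h i)) ≡ fold n (λ j → fold m (λ i → h i j))
  fold-comm 0       n h = begin
    fold 0 _
      ≡⟨ fold-zero _ ⟩
    ε
      ≡⟨ fold-ε n ⟨
    fold n (const ε)
      ≡⟨ fold-cong n (λ j → fold-zero _) ⟨
    fold n (λ j → fold 0 (λ i → h i j))
      ∎
  fold-comm (suc m) n h = begin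
    fold (suc m) (λ i → fold n (h i))
      ≡⟨ fold-suc m _ ⟩
    fold n (h zero) ∙ fold m (λ i → fold n (h (suc i)))
      ≡⟨ cong (fold n (h zero) ∙_) (fold-comm m n (h ∘ suc)) ⟩
    fold n (h zero) ∙ fold n (λ j → fold m (λ i → h (suc i) j))
      ≡⟨ fold-distrib n _ _ ⟨
    fold n (λ j → h zero j ∙ fold m (λ i → h (suc i) j))
      ≡⟨ fold-cong n (λ j → fold-suc m _) ⟨
    fold n (λ j → fold (suc m) (λ i → h i j))
      ∎

  fold-↑ : ∀ m n (h : Fin (m + n) → A) →
           fold (m + n) h ≡ fold m (λ i → h (i ↑ˡ n)) ∙ fold n (λ j → h (m ↑ʳ j))
  fold-↑ 0       n h = trans (sym (identityˡ _)) (cong (_∙ fold n h) (sym (fold-zero _)))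
  fold-↑ (suc m) n h = begin
    fold (suc (m + n)) h
      ≡⟨ fold-suc (m + n) h ⟩
    h zero ∙ fold (m + n) (h ∘ suc)
      ≡⟨ cong (h zero ∙_) (fold-↑ m n (h ∘ suc)) ⟩
    h zero ∙ (fold m (λ i → h (suc (i ↑ˡ n))) ∙ fold n (λ j → h (suc m ↑ʳ j)))
      ≡⟨ assoc _ _ _ ⟨
    (h zero ∙ fold m (λ i → h (suc (i ↑ˡ n)))) ∙ fold n (λ j → h (suc m ↑ʳ j))
      ≡⟨ cong (_∙ _) (fold-suc m _) ⟨
    fold (suc m) (λ i → h (i ↑ˡ n)) ∙ fold n (λ j → h (suc m ↑ʳ j))
      ∎

  fold-combine : ∀ m n (h : Fin (m * n) → A) →
                 fold (m * n) h ≡ fold m (λ i → fold n (λ j → h (combine i j)))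
  fold-combine 0       n h = trans (fold-zero h) (sym (fold-zero _))
  fold-combine (suc m) n h = begin
    fold (n + m * n) h
      ≡⟨ fold-↑ n (m * n) h ⟩
    fold n (λ j → h (j ↑ˡ m * n)) ∙ fold (m * n) (λ x → h (n ↑ʳ x))
      ≡⟨ cong (fold n (λ j → h (j ↑ˡ m * n)) ∙_) (fold-combine m n _) ⟩
    fold n (λ j → h (j ↑ˡ m * n)) ∙ fold m (λ i → fold n (λ j → h (n ↑ʳ combine i j)))
      ≡⟨ fold-suc m _ ⟨
    fold (suc m) (λ i → fold n (λ j → h (combine i j)))
      ∎

module Σ = FinFold ℚ.+-0-isCommutativeMonoid sumFin (λ _ → refl) (λ _ _ → refl)
module Π = FinFold ℚ.*-1-isCommutativeMonoid prodFin (λ _ → refl) (λ _ _ → refl)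

Extensional : ∀ {k m} → ((Fin k → Fin m) → ℚ) → Set
Extensional g = ∀ {φ φ′} → φ ≗ φ′ → g φ ≡ g φ′

sumMaps-cong : ∀ n m {f g : (Fin n → Fin m) → ℚ} → (∀ φ → f φ ≡ g φ) → sumMaps n m f ≡ sumMaps n m g
sumMaps-cong 0       m f≗g = f≗g _
sumMaps-cong (suc n) m f≗g = Σ.fold-cong m (λ i → sumMaps-cong n m (f≗g ∘ (i ∷_)))

∷-cong-tail : ∀ {n m} (i : Fin m) {φ φ′ : Fin n → Fin m} → φ ≗ φ′ → (i ∷ φ) ≗ (i ∷ φ′)
∷-cong-tail i φ≗φ′ zero    = refl
∷-cong-tail i φ≗φ′ (suc x) = φ≗φ′ x

∷-++ : ∀ {a b m} (i : Fin m) (φ : Fin a → Fin m) (ψ : Fin b → Fin m) → (i ∷ (φ ++ ψ)) ≗ ((i ∷ φ) ++ ψ)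
∷-++         i φ ψ zero    = refl
∷-++ {a = a} i φ ψ (suc x) with splitAt a x
... | inj₁ _ = refl
... | inj₂ _ = refl

sumMaps-++ : ∀ a b m (g : (Fin (a + b) → Fin m) → ℚ) → Extensional g →
             sumMaps (a + b) m g ≡ sumMaps a m (λ φ → sumMaps b m (λ ψ → g (φ ++ ψ)))
sumMaps-++ 0       b m g ext = sumMaps-cong b m (λ ψ → ext (λ _ → refl))
sumMaps-++ (suc a) b m g ext = Σ.fold-cong m λ i → begin
  sumMaps (a + b) m (g ∘ (i ∷_))
    ≡⟨ sumMaps-++ a b m _ (ext ∘ ∷-cong-tail i) ⟩
  sumMaps a m (λ φ → sumMaps b m (λ ψ → g (i ∷ (φ ++ ψ))))
    ≡⟨ sumMaps-cong a m (λ φ → sumMaps-cong b m (λ ψ → ext (∷-++ i φ ψ))) ⟩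
  sumMaps a m (λ φ → sumMaps b m (λ ψ → g ((i ∷ φ) ++ ψ)))
    ∎
  where open ≡-Reasoning

finToFun-combine : ∀ {k m} (i : Fin m) (j : Fin (m ^ k)) → finToFun {m} {suc k} (combine i j) ≗ (i ∷ finToFun j)
finToFun-combine i j zero    = cong proj₁ (remQuot-combine i j)
finToFun-combine i j (suc x) = cong (λ q → finToFun (proj₂ q) x) (remQuot-combine i j)

sumMaps-finToFun : ∀ k m (g : (Fin k → Fin m) → ℚ) → Extensional g →
                   sumMaps k m g ≡ sumFin (m ^ k) (g ∘ finToFun)
sumMaps-finToFun 0       m g ext = trans (ext (λ ())) (sym (ℚ.+-identityʳ _))
sumMaps-finToFun (suc k) m g ext = begin
  sumFin m (λ i → sumMaps k m (g ∘ (i ∷_)))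
    ≡⟨ Σ.fold-cong m (λ i → sumMaps-finToFun k m _ (ext ∘ ∷-cong-tail i)) ⟩
  sumFin m (λ i → sumFin (m ^ k) (λ j → g (i ∷ finToFun j)))
    ≡⟨ Σ.fold-cong m (λ i → Σ.fold-cong (m ^ k) (λ j → ext (finToFun-combine i j))) ⟨
  sumFin m (λ i → sumFin (m ^ k) (λ j → g (finToFun (combine i j))))
    ≡⟨ Σ.fold-combine m (m ^ k) _ ⟨
  sumFin (m * m ^ k) (g ∘ finToFun)
    ∎
  where open ≡-Reasoning

blowupMap : ∀ {n m} r → (Fin n → Fin (m ^ r)) → Fin (n * r) → Fin m
blowupMap {n} r ψ x = finToFun (ψ (proj₁ (remQuot {n} r x))) (proj₂ (remQuot {n} r x))

blowupMap-∷ : ∀ {n m} r (k : Fin (m ^ r)) (ψ : Fin n → Fin (m ^ r)) →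
              (finToFun k ++ blowupMap r ψ) ≗ blowupMap {suc n} r (k ∷ ψ)
blowupMap-∷ r k ψ x with splitAt r x
... | inj₁ _ = refl
... | inj₂ _ = refl

sumMaps-blowup : ∀ n r m (g : (Fin (n * r) → Fin m) → ℚ) → Extensional g →
                 sumMaps (n * r) m g ≡ sumMaps n (m ^ r) (g ∘ blowupMap r)
sumMaps-blowup 0       r m g ext = ext (λ ())
sumMaps-blowup (suc n) r m g ext = begin
  sumMaps (r + n * r) m g
    ≡⟨ sumMaps-++ r (n * r) m g ext ⟩
  sumMaps r m (λ φ → sumMaps (n * r) m (λ ψ → g (φ ++ ψ)))
    ≡⟨ sumMaps-cong r m (λ φ → sumMaps-blowup n r m _ (λ {ψ} {ψ′} → ext ∘ ++-cong {ys = ψ} {ψ′} φ φ (λ _ → refl))) ⟩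
  sumMaps r m (λ φ → sumMaps n (m ^ r) (λ ψ → g (φ ++ blowupMap r ψ)))
    ≡⟨ sumMaps-finToFun r m _ (λ φ≗φ′ → sumMaps-cong n (m ^ r) (λ ψ → ext (++-cong _ _ φ≗φ′ (λ _ → refl)))) ⟩
  sumFin (m ^ r) (λ k → sumMaps n (m ^ r) (λ ψ → g (finToFun k ++ blowupMap r ψ)))
    ≡⟨ Σ.fold-cong (m ^ r) (λ k → sumMaps-cong n (m ^ r) (λ ψ → ext (blowupMap-∷ r k ψ))) ⟩
  sumMaps (suc n) (m ^ r) (g ∘ blowupMap r)
    ∎
  where open ≡-Reasoning

homTerm : ∀ {n m} → SimpleGraph n → (Fin m → Fin m → ℚ) → (Fin n → Fin m) → ℚ
homTerm {n} G β φ = prodFin n (λ u → prodFin n (λ v →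
  if adj G u v ∧ (toℕ u <ᵇ toℕ v) then β (φ u) (φ v) else 1ℚ))

homTerm-extensional : ∀ {n m} (G : SimpleGraph n) (β : Fin m → Fin m → ℚ) → Extensional (homTerm G β)
homTerm-extensional {n} G β φ≗φ′ = Π.fold-cong n (λ u → Π.fold-cong n (λ v →
  cong₂ (λ s t → if adj G u v ∧ (toℕ u <ᵇ toℕ v) then β s t else 1ℚ) (φ≗φ′ u) (φ≗φ′ v)))

tupleWeights : ∀ {m} r → (Fin m → Fin m → ℚ) → Fin (m ^ r) → Fin (m ^ r) → ℚ
tupleWeights r β k l = prodFin r (λ a → prodFin r (λ b → β (finToFun k a) (finToFun l b)))

tupleWeights-sym : ∀ {m} r (β : Fin m → Fin m → ℚ) →
                   SymmetricWeights m β → SymmetricWeights (m ^ r) (tupleWeights r β)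
tupleWeights-sym r β β-sym k l =
  trans (Π.fold-cong r (λ a → Π.fold-cong r (λ b → β-sym _ _))) (Π.fold-comm r r _)

<ᵇ-true : ∀ {m n} → m < n → (m <ᵇ n) ≡ true
<ᵇ-true {0}     {suc n} _         = refl
<ᵇ-true {suc m} {suc n} (s≤s m<n) = <ᵇ-true m<n

<ᵇ-false : ∀ {m n} → n ≤ m → (m <ᵇ n) ≡ false
<ᵇ-false {m}     {0}     _         = refl
<ᵇ-false {suc m} {suc n} (s≤s n≤m) = <ᵇ-false n≤m

combine-<ᵇ : ∀ {n r} {u v : Fin n} (a b : Fin r) → u ≢ v →
             (toℕ (combine u a) <ᵇ toℕ (combine v b)) ≡ (toℕ u <ᵇ toℕ v)
combine-<ᵇ {u = u} {v} a b u≢v with <-cmp u v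
... | tri< u<v _ _ = trans (<ᵇ-true (combine-monoˡ-< a b u<v)) (sym (<ᵇ-true u<v))
... | tri≈ _ u≡v _ = contradiction u≡v u≢v
... | tri> _ _ v<u = trans (<ᵇ-false (<⇒≤ (combine-monoˡ-< b a v<u))) (sym (<ᵇ-false (<⇒≤ v<u)))

adj⇒≢ : ∀ {n} (G : SimpleGraph n) {u v : Fin n} → adj G u v ≡ true → u ≢ v
adj⇒≢ G {u} uv∈E refl with trans (sym uv∈E) (irrefl G u)
... | ()

prodFin²-if : ∀ r (c : Bool) (X : Fin r → Fin r → ℚ) →
              prodFin r (λ a → prodFin r (λ b → if c then X a b else 1ℚ))
              ≡ (if c then prodFin r (λ a → prodFin r (X a)) else 1ℚ)
prodFin²-if r true  X = refl
prodFin²-if r false X = trans (Π.fold-cong r (λ _ → Π.fold-ε r)) (Π.fold-ε r)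

twinEdges : ∀ {n} r (G : SimpleGraph n) (u v : Fin n) (X : Fin r → Fin r → ℚ) →
  prodFin r (λ a → prodFin r (λ b → if adj G u v ∧ (toℕ (combine u a) <ᵇ toℕ (combine v b)) then X a b else 1ℚ))
  ≡ (if adj G u v ∧ (toℕ u <ᵇ toℕ v) then prodFin r (λ a → prodFin r (X a)) else 1ℚ)
twinEdges r G u v X with adj G u v in uv∈E
... | false = prodFin²-if r false X
... | true  = trans
  (Π.fold-cong r (λ a → Π.fold-cong r (λ b → cong (λ c → if c then X a b else 1ℚ) (combine-<ᵇ a b (adj⇒≢ G uv∈E)))))
  (prodFin²-if r (toℕ u <ᵇ toℕ v) X)

blowupFactor-combine : ∀ {n m r} (G : SimpleGraph n) (β : Fin m → Fin m → ℚ) (ψ : Fin n → Fin (m ^ r)) u v a b →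
  (if adj (blowup G r) (combine u a) (combine v b) ∧ (toℕ (combine u a) <ᵇ toℕ (combine v b))
     then β (blowupMap r ψ (combine u a)) (blowupMap r ψ (combine v b)) else 1ℚ)
  ≡ (if adj G u v ∧ (toℕ (combine u a) <ᵇ toℕ (combine v b))
     then β (finToFun (ψ u) a) (finToFun (ψ v) b) else 1ℚ)
blowupFactor-combine {n} {r = r} G β ψ u v a b =
  cong₂ (λ (ua vb : Fin n × Fin r) → if adj G (proj₁ ua) (proj₁ vb) ∧ (toℕ (combine u a) <ᵇ toℕ (combine v b))
           then β (finToFun (ψ (proj₁ ua)) (proj₂ ua)) (finToFun (ψ (proj₁ vb)) (proj₂ vb)) else 1ℚ)
    (remQuot-combine u a) (remQuot-combine v b)

homTerm-blowup : ∀ {n m} (G : SimpleGraph n) r (β : Fin m → Fin m → ℚ) (ψ : Fin n → Fin (m ^ r)) →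
                 homTerm (blowup G r) β (blowupMap r ψ) ≡ homTerm G (tupleWeights r β) ψ
homTerm-blowup {n} G r β ψ = begin
  homTerm (blowup G r) β (blowupMap r ψ)
    ≡⟨ Π.fold-combine n r _ ⟩
  prodFin n (λ u → prodFin r (λ a → prodFin (n * r) (F (combine u a))))
    ≡⟨ Π.fold-cong n (λ u → Π.fold-cong r (λ a → Π.fold-combine n r _)) ⟩
  prodFin n (λ u → prodFin r (λ a → prodFin n (λ v → prodFin r (λ b → F (combine u a) (combine v b)))))
    ≡⟨ Π.fold-cong n (λ u → Π.fold-comm r n _) ⟩
  prodFin n (λ u → prodFin n (λ v → prodFin r (λ a → prodFin r (λ b → F (combine u a) (combine v b)))))
    ≡⟨ Π.fold-cong n (λ u → Π.fold-cong n (λ v → trans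
         (Π.fold-cong r (λ a → Π.fold-cong r (λ b → blowupFactor-combine G β ψ u v a b)))
         (twinEdges r G u v _))) ⟩
  homTerm G (tupleWeights r β) ψ
    ∎
  where
  open ≡-Reasoning
  F : Fin (n * r) → Fin (n * r) → ℚ
  F x y = if adj (blowup G r) x y ∧ (toℕ x <ᵇ toℕ y) then β (blowupMap r ψ x) (blowupMap r ψ y) else 1ℚ

hom-blowup : ∀ {n} (G : SimpleGraph n) r m (β : Fin m → Fin m → ℚ) →
             hom (blowup G r) m β ≡ hom G (m ^ r) (tupleWeights r β)
hom-blowup {n} G r m β =
  trans (sumMaps-blowup n r m _ (homTerm-extensional (blowup G r) β))
        (sumMaps-cong n (m ^ r) (homTerm-blowup G r β))

mainTheorem9 : ∀ {n} (G : SimpleGraph n) → Positive G →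
                 ∀ (r : ℕ) → 0 < r → Positive (blowup G r)
mainTheorem9 G G-positive r _ m β β-sym =
  subst (0ℚ ≤ℚ_) (sym (hom-blowup G r m β))
    (G-positive (m ^ r) (tupleWeights r β) (tupleWeights-sym r β β-sym))
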